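{- A bipartite graph $B$ is an interval bigraph if and only if $\widehat{B}$ is a $2$-clique rectangular graph such that there is a rectangular representation of $\widehat{B}$ in which for every pair of rectangles, their projections intersect on at least one of the axes.
   Context: A bipartite graph (bigraph) $B(X,Y,E)$ is an interval bigraph if there are intervals $I_v$ on the real line, $v\in X\cup Y$, such that for $u\in X$, $v\in Y$, $uv\in E$ iff $I_u\cap I_v\neq\emptyset$. For $B$ with biadjacency matrix $A$ (rows indexed by $X$, columns by $Y$), $\widehat{B}$ denotes the graph with adjacency matrix $\begin{pmatrix}\mathbf{1} & A\\ A^T & \mathbf{1}\end{pmatrix}$, i.e. $B$ with each partite set made into a clique and a loop added at every vertex. A rectangular graph is an intersection graph of axis-parallel rectangles in $\mathbb{R}^2$; a $2$-clique rectangular graph is a rectangular graph whose vertices are covered by two disjoint cliques.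
   Formalization: The intervals are taken with endpoints in ℚ rather than on the real line, and the rectangles in ℚ² rather than in ℝ². -}

module Defs where

open import Data.Bool using (Bool; true; false)
open import Data.Nat using (ℕ; _+_)
open import Data.Fin using (Fin; splitAt)
open import Data.Sum using (_⊎_; inj₁; inj₂)
open import Data.Product using (Σ; _×_; _,_; ∃; ∃-syntax)
open import Data.Rational using (ℚ; _≤_)
open import Relation.Binary.PropositionalEquality using (_≡_; _≢_)
open import Relation.Nullary using (¬_)
open import Function.Bundles using (_⇔_)

-- Bigraphs B(X,Y,E) with |X| = m, |Y| = n, given by the biadjacency
-- matrix A (rows indexed by X, columns by Y).

BiadjMatrix : ℕ → ℕ → Set
BiadjMatrix m n = Fin m → Fin n → Bool

AdjMatrix : ℕ → Set
AdjMatrix N = Fin N → Fin N → Bool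

record Interval : Set where
  constructor [_,_]⟨_⟩
  field
    lo : ℚ
    hi : ℚ
    lo≤hi : lo ≤ hi
open Interval public

Meets : Interval → Interval → Set
Meets I J = (lo I ≤ hi J) × (lo J ≤ hi I)

IsIntervalBigraph : ∀ {m n} → BiadjMatrix m n → Set
IsIntervalBigraph {m} {n} A =
  Σ (Fin m → Interval) λ IX → Σ (Fin n → Interval) λ IY →
    (i : Fin m) (j : Fin n) → (A i j ≡ true) ⇔ Meets (IX i) (IY j)

-- B̂ : adjacency matrix ( 1  A ; Aᵀ 1 ) on Fin (m + n); the first m
-- vertices are X, the last n are Y.

hat : ∀ {m n} → BiadjMatrix m n → AdjMatrix (m + n)
hat {m} A u v with splitAt m u | splitAt m v
... | inj₁ _ | inj₁ _ = true
... | inj₁ i | inj₂ j = A i j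
... | inj₂ j | inj₁ i = A i j
... | inj₂ _ | inj₂ _ = true

record Rectangle : Set where
  constructor _⊠_
  field
    xproj : Interval
    yproj : Interval
open Rectangle public

RectMeets : Rectangle → Rectangle → Set
RectMeets R S = Meets (xproj R) (xproj S) × Meets (yproj R) (yproj S)

IsRectRep : ∀ {N} → AdjMatrix N → (Fin N → Rectangle) → Set
IsRectRep {N} G R =
  (u v : Fin N) → u ≢ v → (G u v ≡ true) ⇔ RectMeets (R u) (R v)

IsRectangular : ∀ {N} → AdjMatrix N → Set
IsRectangular {N} G = Σ (Fin N → Rectangle) λ R → IsRectRep G R

-- the vertices are covered by two disjoint cliques: a 2-colouring c
-- whose colour classes are cliques
HasTwoCliqueCover : ∀ {N} → AdjMatrix N → Set
HasTwoCliqueCover {N} G =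
  Σ (Fin N → Bool) λ c →
    (u v : Fin N) → u ≢ v → c u ≡ c v → G u v ≡ true

IsTwoCliqueRectangular : ∀ {N} → AdjMatrix N → Set
IsTwoCliqueRectangular G = IsRectangular G × HasTwoCliqueCover G

ProjectionsCross : ∀ {N} → (Fin N → Rectangle) → Set
ProjectionsCross {N} R =
  (u v : Fin N) → Meets (xproj (R u)) (xproj (R v)) ⊎ Meets (yproj (R u)) (yproj (R v))

-- (⇒) Given intervals I_v, send x ∈ X to [lo I_x, U] × [L, hi I_x] and
--   y ∈ Y to [L, hi I_y] × [lo I_y, U] for global bounds L ≤ U.  Same-side
--   rectangles share a corner, and x, y meet iff I_x, I_y meet.  The two
--   sides of B̂ form the required clique cover.
-- (⇐) X and Y are cliques of B̂, so on each axis the projections of X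
--   pairwise meet, and so do those of Y.  Two such families of intervals
--   meet in a threshold pattern "c j ≤ b i" (`cliquesMeetAsThreshold`).
--   Hence E = S ∩ T for threshold relations S, T with S ∪ T complete
--   (the crossing hypothesis).  Such an intersection is always realised
--   by intervals (`intervalOfThresholds`): this is the heart of the proof.
--   The endpoints are built from the "staircase" of points (c j, c' j) by
--   finite suprema, shifted so that each endpoint comparison tests exactly
--   one of the two thresholds.
module Submission where

open import Defs
open import Data.Nat using (ℕ; _+_)
open import Data.Fin using (Fin; splitAt; _↑ˡ_; _↑ʳ_)
open import Data.Fin.Properties using (splitAt-↑ˡ; splitAt-↑ʳ; ↑ˡ-injective; ↑ʳ-injective; any?)
  renaming (_≟_ to _≟ᶠ_)
open import Data.List using (tabulate)
import Data.List.Extrema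
import Data.List.Relation.Unary.All.Properties as All
open import Data.Product using (Σ; _×_; _,_; proj₁; proj₂; swap)
open import Data.Product.Function.NonDependent.Propositional using (_×-⇔_)
open import Data.Sum using (_⊎_; inj₁; inj₂; [_,_]′)
import Data.Sum as Sum
open import Data.Bool using (Bool; true; false; if_then_else_)
open import Data.Empty using (⊥-elim)
open import Function.Base using (_∘_; id)
open import Function.Bundles using (_⇔_; mk⇔; module Equivalence)
open Equivalence using (to)
open import Function.Properties.Equivalence using () renaming (trans to ⇔-trans; sym to ⇔-sym)
open import Level using (0ℓ)
open import Relation.Binary.Bundles using (DecTotalOrder)
open import Relation.Binary.PropositionalEquality using (_≡_; refl; _≢_; sym; trans; cong; subst)
open import Relation.Nullary using (yes; no; does; ¬_)
open import Relation.Nullary.Decidable using (dec-true)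
open import Relation.Unary using (Pred; Decidable)
open import Data.Rational using (ℚ; 0ℚ; _≤_; _<_; _-_; -_)
open import Data.Rational.Properties
  using (≤-refl; ≤-trans; _≤?_; _<?_; ≮⇒≥; ≰⇒>; <⇒≤; <-irrefl; <-≤-trans; ≤-<-trans; <-trans;
         neg-antimono-≤; neg-antimono-<; +-mono-≤; +-mono-<-≤; +-mono-≤-<; ≤-decTotalOrder)

<⇒≱ : ∀ {p q} → p < q → ¬ q ≤ p
<⇒≱ p<q q≤p = <-irrefl refl (<-≤-trans p<q q≤p)

neg-cancel-≤ : ∀ {p q} → - p ≤ - q → q ≤ p
neg-cancel-≤ -p≤-q = ≮⇒≥ (λ p<q → <⇒≱ (neg-antimono-< p<q) -p≤-q)

sub-mono : ∀ {a a' e e'} → a ≤ a' → e' ≤ e → a - e ≤ a' - e'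
sub-mono a≤a' e'≤e = +-mono-≤ a≤a' (neg-antimono-≤ e'≤e)

sub-mono-<≤ : ∀ {a a' e e'} → a < a' → e' ≤ e → a - e < a' - e'
sub-mono-<≤ a<a' e'≤e = +-mono-<-≤ a<a' (neg-antimono-≤ e'≤e)

sub-mono-≤< : ∀ {a a' e e'} → a ≤ a' → e' < e → a - e < a' - e'
sub-mono-≤< a≤a' e'<e = +-mono-≤-< a≤a' (neg-antimono-< e'<e)

private
  module Extrema = Data.List.Extrema (DecTotalOrder.totalOrder ≤-decTotalOrder)

maxFrom : ∀ {k} → ℚ → (Fin k → ℚ) → ℚ
maxFrom d f = Extrema.max d (tabulate f)

maxFrom-default : ∀ {k} d (f : Fin k → ℚ) → d ≤ maxFrom d f
maxFrom-default d f = Extrema.⊥≤max d (tabulate f)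

maxFrom-≥ : ∀ {k} d (f : Fin k → ℚ) i → f i ≤ maxFrom d f
maxFrom-≥ d f = All.tabulate⁻ (Extrema.xs≤max d (tabulate f))

maxFrom-lub : ∀ {k u} d (f : Fin k → ℚ) → d ≤ u → (∀ i → f i ≤ u) → maxFrom d f ≤ u
maxFrom-lub d f d≤u f≤u = Extrema.max≤v⁺ d≤u (All.tabulate⁺ f≤u)

minFrom : ∀ {k} → ℚ → (Fin k → ℚ) → ℚ
minFrom d f = Extrema.min d (tabulate f)

minFrom-default : ∀ {k} d (f : Fin k → ℚ) → minFrom d f ≤ d
minFrom-default d f = Extrema.min≤⊤ d (tabulate f)

minFrom-≤ : ∀ {k} d (f : Fin k → ℚ) i → minFrom d f ≤ f i
minFrom-≤ d f = All.tabulate⁻ (Extrema.min≤xs d (tabulate f))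

-- The supremum of f over the points satisfying a decidable P, or the
-- default d if there are none (values below d are ignored).

module _ {k} {P : Pred (Fin k) 0ℓ} (P? : Decidable P) (f : Fin k → ℚ) (d : ℚ) where

  private
    candidate : Fin k → ℚ
    candidate i = if does (P? i) then f i else d

  supWhere : ℚ
  supWhere = maxFrom d candidate

  supWhere-default : d ≤ supWhere
  supWhere-default = maxFrom-default d candidate

  supWhere-≥ : ∀ {i} → P i → f i ≤ supWhere
  supWhere-≥ {i} p = ≤-trans selected (maxFrom-≥ d candidate i)
    where
    selected : f i ≤ candidate i
    selected rewrite dec-true (P? i) p = ≤-refl

  supWhere-lub : ∀ {u} → d ≤ u → (∀ i → P i → f i ≤ u) → supWhere ≤ u
  supWhere-lub {u} d≤u f≤u = maxFrom-lub d candidate d≤u bounded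
    where
    bounded : ∀ i → candidate i ≤ u
    bounded i with P? i
    ... | yes p = f≤u i p
    ... | no _ = d≤u

supWhere-mono : ∀ {k} {P Q : Pred (Fin k) 0ℓ} (P? : Decidable P) (Q? : Decidable Q) f d →
                (∀ i → P i → Q i) → supWhere P? f d ≤ supWhere Q? f d
supWhere-mono P? Q? f d P⊆Q =
  supWhere-lub P? f d (supWhere-default Q? f d) (λ i p → supWhere-≥ Q? f d (P⊆Q i p))

module Staircase {n} (c c' : Fin n → ℚ) (d : ℚ) where

  atLeast? : (y : ℚ) → Decidable (λ k → y ≤ c' k)
  atLeast? y k = y ≤? c' k

  above? : (y : ℚ) → Decidable (λ k → y < c' k)
  above? y k = y <? c' k

  reach≥ reach> : ℚ → ℚ
  reach≥ y = supWhere (atLeast? y) c d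
  reach> y = supWhere (above? y) c d

  reach≥-self : ∀ k → c k ≤ reach≥ (c' k)
  reach≥-self k = supWhere-≥ (atLeast? (c' k)) c d ≤-refl

  reach>-≤ : ∀ {x y} → d ≤ x → (∀ k → c k ≤ x ⊎ c' k ≤ y) → reach> y ≤ x
  reach>-≤ {x} {y} d≤x undominated = supWhere-lub (above? y) c d d≤x below
    where
    below : ∀ k → y < c' k → c k ≤ x
    below k y<c'k = [ id , (λ c'k≤y → ⊥-elim (<⇒≱ y<c'k c'k≤y)) ]′ (undominated k)

  reach>≤reach≥ : ∀ {y z} → z ≤ y → reach> y ≤ reach≥ z
  reach>≤reach≥ {y} {z} z≤y =
    supWhere-mono (above? y) (atLeast? z) c d (λ k y<c'k → ≤-trans z≤y (<⇒≤ y<c'k))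

  reach≥≤reach> : ∀ {y z} → y < z → reach≥ z ≤ reach> y
  reach≥≤reach> {y} {z} y<z =
    supWhere-mono (atLeast? z) (above? y) c d (λ k z≤c'k → <-≤-trans y<z z≤c'k)

  -- Shifting by the height turns reach into an exact test of z ≤ y, on
  -- either side of the comparison.
  shiftedReach-≤⇔ : ∀ {y z} → (reach> y - y ≤ reach≥ z - z) ⇔ (z ≤ y)
  shiftedReach-≤⇔ {y} {z} = mk⇔
    (λ le → ≮⇒≥ (λ y<z → <⇒≱ (sub-mono-≤< (reach≥≤reach> y<z) y<z) le))
    (λ z≤y → sub-mono (reach>≤reach≥ z≤y) z≤y)

  heightMinusReach-≤⇔ : ∀ {y z} → (z - reach≥ z ≤ y - reach> y) ⇔ (z ≤ y)
  heightMinusReach-≤⇔ {y} {z} = mk⇔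
    (λ le → ≮⇒≥ (λ y<z → <⇒≱ (sub-mono-<≤ y<z (reach≥≤reach> y<z)) le))
    (λ z≤y → sub-mono z≤y (reach>≤reach≥ z≤y))

IntervalRelation : ∀ {m n} → (Fin m → Fin n → Set) → Set
IntervalRelation {m} {n} S =
  Σ (Fin m → Interval) λ IX → Σ (Fin n → Interval) λ IY →
    ∀ i j → S i j ⇔ Meets (IX i) (IY j)

Threshold : ∀ {m n} → (Fin m → Fin n → Set) → Set
Threshold {m} {n} S =
  Σ (Fin m → ℚ) λ b → Σ (Fin n → ℚ) λ c → ∀ i j → S i j ⇔ (c j ≤ b i)

IntervalRelation-resp : ∀ {m n} {S T : Fin m → Fin n → Set} →
                        (∀ i j → S i j ⇔ T i j) → IntervalRelation S → IntervalRelation T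
IntervalRelation-resp S⇔T (IX , IY , rep) = IX , IY , λ i j → ⇔-trans (⇔-sym (S⇔T i j)) (rep i j)

-- Write r(z), R(y) for reach≥, reach> on the
-- staircase of points (c k, c' k), and h(z), H(y) for those on (c' k, c k).
-- Then  I_i = [H(b i) - b i, b' i - R(b' i)]  and  J_j = [c' j - r(c' j), h(c j) - c j]
-- work: the two endpoint comparisons test exactly c j ≤ b i and c' j ≤ b' i.
-- The defaults lie below every b i (resp. b' i), so that completeness
-- bounds the reach> values and the intervals I_i are nonempty.
thresholdIntersection : ∀ {m n} (b b' : Fin m → ℚ) (c c' : Fin n → ℚ) →
  (∀ i j → c j ≤ b i ⊎ c' j ≤ b' i) →
  IntervalRelation (λ i j → c j ≤ b i × c' j ≤ b' i)
thresholdIntersection {m} {n} b b' c c' complete = IX , IY , meets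
  where
  module Cs  = Staircase c c' (minFrom 0ℚ b)
  module C's = Staircase c' c (minFrom 0ℚ b')

  IX : Fin m → Interval
  IX i = [ C's.reach> (b i) - b i , b' i - Cs.reach> (b' i) ]⟨
           sub-mono (C's.reach>-≤ (minFrom-≤ 0ℚ b' i) (Sum.swap ∘ complete i))
                    (Cs.reach>-≤ (minFrom-≤ 0ℚ b i) (complete i)) ⟩

  IY : Fin n → Interval
  IY j = [ c' j - Cs.reach≥ (c' j) , C's.reach≥ (c j) - c j ]⟨
           sub-mono (C's.reach≥-self j) (Cs.reach≥-self j) ⟩

  meets : ∀ i j → (c j ≤ b i × c' j ≤ b' i) ⇔ Meets (IX i) (IY j)
  meets i j = ⇔-sym (C's.shiftedReach-≤⇔ ×-⇔ Cs.heightMinusReach-≤⇔)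

intervalOfThresholds : ∀ {m n} {S T : Fin m → Fin n → Set} →
  Threshold S → Threshold T → (∀ i j → S i j ⊎ T i j) →
  IntervalRelation (λ i j → S i j × T i j)
intervalOfThresholds (b , c , S⇔) (b' , c' , T⇔) S∪T =
  IntervalRelation-resp (λ i j → ⇔-sym (S⇔ i j ×-⇔ T⇔ i j))
    (thresholdIntersection b b' c c' (λ i j → Sum.map (to (S⇔ i j)) (to (T⇔ i j)) (S∪T i j)))

-- If some Y-interval lies left of some X-interval,
-- then no Y-interval lies right of any X-interval, so meeting is decided
-- by "lo X ≤ hi Y" alone; otherwise it is decided by "lo Y ≤ hi X".
cliquesMeetAsThreshold : ∀ {m n} (XI : Fin m → Interval) (YI : Fin n → Interval) →
  (∀ i i' → Meets (XI i) (XI i')) → (∀ j j' → Meets (YI j) (YI j')) →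
  Threshold (λ i j → Meets (XI i) (YI j))
cliquesMeetAsThreshold XI YI XX YY with any? (λ i → any? (λ j → hi (YI j) <? lo (XI i)))
... | no noneLeft =
  (hi ∘ XI) , (lo ∘ YI) , λ i j →
    mk⇔ proj₂ (λ lo≤hi → ≮⇒≥ (λ left → noneLeft (i , j , left)) , lo≤hi)
... | yes (i₀ , j₀ , left₀) =
  (λ i → - lo (XI i)) , (λ j → - hi (YI j)) , λ i j →
    mk⇔ (neg-antimono-≤ ∘ proj₁) (λ le → neg-cancel-≤ le , noneRight i j)
  where
  noneRight : ∀ i j → lo (YI j) ≤ hi (XI i)
  noneRight i j = ≮⇒≥ λ right → <-irrefl refl
    (≤-<-trans (proj₁ (XX i₀ i)) (<-trans (<-≤-trans right (proj₁ (YY j j₀))) left₀))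

Meets-refl : ∀ I → Meets I I
Meets-refl I = lo≤hi I , lo≤hi I

RectMeets-sym⇔ : ∀ S S' → RectMeets S S' ⇔ RectMeets S' S
RectMeets-sym⇔ S S' = mk⇔ (flip {S} {S'}) (flip {S'} {S})
  where
  flip : ∀ {S S'} → RectMeets S S' → RectMeets S' S
  flip (p , q) = swap p , swap q

cliqueRectanglesMeet : ∀ {N k} {G : AdjMatrix N} {R : Fin N → Rectangle} (f : Fin k → Fin N) →
  (∀ a a' → f a ≡ f a' → a ≡ a') → IsRectRep G R →
  (∀ a a' → G (f a) (f a') ≡ true) → ∀ a a' → RectMeets (R (f a)) (R (f a'))
cliqueRectanglesMeet {R = R} f injective rep clique a a' with a ≟ᶠ a'
... | yes refl = Meets-refl (xproj (R (f a))) , Meets-refl (yproj (R (f a)))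
... | no a≢a' = to (rep (f a) (f a') (a≢a' ∘ injective a a')) (clique a a')

module _ {m n} (A : BiadjMatrix m n) where

  hat-XX : ∀ i i' → hat A (i ↑ˡ n) (i' ↑ˡ n) ≡ true
  hat-XX i i' rewrite splitAt-↑ˡ m i n | splitAt-↑ˡ m i' n = refl

  hat-YY : ∀ j j' → hat A (m ↑ʳ j) (m ↑ʳ j') ≡ true
  hat-YY j j' rewrite splitAt-↑ʳ m n j | splitAt-↑ʳ m n j' = refl

  hat-XY : ∀ i j → hat A (i ↑ˡ n) (m ↑ʳ j) ≡ A i j
  hat-XY i j rewrite splitAt-↑ˡ m i n | splitAt-↑ʳ m n j = refl

-- splitAt sends the two sides to different summands, so they are disjoint
↑ˡ≢↑ʳ : ∀ {m n} (i : Fin m) (j : Fin n) → i ↑ˡ n ≢ m ↑ʳ j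
↑ˡ≢↑ʳ {m} {n} i j eq
  with trans (sym (splitAt-↑ˡ m i n)) (trans (cong (splitAt m) eq) (splitAt-↑ʳ m n j))
... | ()

-- (⇐) A crossing rectangle representation of B̂ yields an interval model of B:
-- on each axis the two sides meet in a threshold pattern, an edge means
-- meeting on both axes, and crossing says every pair meets on one axis.
rectangularToInterval : ∀ {m n} (A : BiadjMatrix m n) (R : Fin (m + n) → Rectangle) →
  IsRectRep (hat A) R → ProjectionsCross R → IsIntervalBigraph A
rectangularToInterval {m} {n} A R rep cross =
  IntervalRelation-resp edge⇔
    (intervalOfThresholds (onAxis xproj proj₁) (onAxis yproj proj₂)
                          (λ i j → cross (i ↑ˡ n) (m ↑ʳ j)))
  where
  XX : ∀ i i' → RectMeets (R (i ↑ˡ n)) (R (i' ↑ˡ n))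
  XX = cliqueRectanglesMeet {G = hat A} {R = R} (_↑ˡ n) (↑ˡ-injective n) rep (hat-XX A)

  YY : ∀ j j' → RectMeets (R (m ↑ʳ j)) (R (m ↑ʳ j'))
  YY = cliqueRectanglesMeet {G = hat A} {R = R} (m ↑ʳ_) (↑ʳ-injective m) rep (hat-YY A)

  onAxis : (π : Rectangle → Interval) → (∀ {S S'} → RectMeets S S' → Meets (π S) (π S')) →
           Threshold (λ i j → Meets (π (R (i ↑ˡ n))) (π (R (m ↑ʳ j))))
  onAxis π project = cliquesMeetAsThreshold (π ∘ R ∘ (_↑ˡ n)) (π ∘ R ∘ (m ↑ʳ_))
    (λ i i' → project (XX i i')) (λ j j' → project (YY j j'))

  edge⇔ : ∀ i j → RectMeets (R (i ↑ˡ n)) (R (m ↑ʳ j)) ⇔ (A i j ≡ true)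
  edge⇔ i j = ⇔-sym (subst (λ e → (e ≡ true) ⇔ RectMeets (R (i ↑ˡ n)) (R (m ↑ʳ j)))
                           (hat-XY A i j) (rep _ _ (↑ˡ≢↑ʳ i j)))

hat-twoCliqueCover : ∀ {m n} (A : BiadjMatrix m n) → HasTwoCliqueCover (hat A)
hat-twoCliqueCover {m} {n} A = side , sameSide
  where
  side : Fin (m + n) → Bool
  side u = [ (λ _ → true) , (λ _ → false) ]′ (splitAt m u)

  sameSide : ∀ u v → u ≢ v → side u ≡ side v → hat A u v ≡ true
  sameSide u v _ eq with splitAt m u | splitAt m v
  ... | inj₁ _ | inj₁ _ = refl
  ... | inj₂ _ | inj₂ _ = refl
  ... | inj₁ _ | inj₂ _ with () ← eq
  ... | inj₂ _ | inj₁ _ with () ← eq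

module Corners {V : Set} (J : V → Interval) (L U : ℚ) (L≤U : L ≤ U)
               (lo≤U : ∀ v → lo (J v) ≤ U) (L≤hi : ∀ v → L ≤ hi (J v)) where

  rise fall : V → Interval
  rise v = [ lo (J v) , U ]⟨ lo≤U v ⟩
  fall v = [ L , hi (J v) ]⟨ L≤hi v ⟩

  xCorner yCorner : V → Rectangle
  xCorner v = rise v ⊠ fall v
  yCorner v = fall v ⊠ rise v

  rise-rise : ∀ u v → Meets (rise u) (rise v)
  rise-rise u v = lo≤U u , lo≤U v

  fall-fall : ∀ u v → Meets (fall u) (fall v)
  fall-fall u v = L≤hi v , L≤hi u

  corner-meets : ∀ u v → RectMeets (xCorner u) (yCorner v) ⇔ Meets (J u) (J v)
  corner-meets u v = mk⇔ (λ (p , q) → proj₁ p , proj₂ q) (λ (p , q) → (p , L≤U) , (L≤U , q))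

  -- if J v ends before J u starts, then J v starts before J u ends
  corner-cross : ∀ u v → Meets (rise u) (fall v) ⊎ Meets (fall u) (rise v)
  corner-cross u v with lo (J u) ≤? hi (J v)
  ... | yes lo≤hi = inj₁ (lo≤hi , L≤U)
  ... | no lo≰hi = inj₂ (L≤U , ≤-trans (lo≤hi (J v))
                                  (≤-trans (<⇒≤ (≰⇒> lo≰hi)) (lo≤hi (J u))))

-- (⇒) An interval model of B gives a crossing rectangle representation of
-- B̂: x ∈ X becomes rise × fall and y ∈ Y becomes fall × rise, inside a box
-- [L, U]² containing every left endpoint below U and every right one above L.
intervalToRectangular : ∀ {m n} (A : BiadjMatrix m n) → IsIntervalBigraph A →
  Σ (Fin (m + n) → Rectangle) λ R → IsRectRep (hat A) R × ProjectionsCross R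
intervalToRectangular {m} {n} A (IX , IY , iv) = rect , rep , cross
  where
  J : Fin m ⊎ Fin n → Interval
  J = [ IX , IY ]′

  U L : ℚ
  U = maxFrom (maxFrom 0ℚ (lo ∘ IY)) (lo ∘ IX)
  L = minFrom (minFrom 0ℚ (hi ∘ IY)) (hi ∘ IX)

  lo≤U : ∀ v → lo (J v) ≤ U
  lo≤U (inj₁ i) = maxFrom-≥ _ (lo ∘ IX) i
  lo≤U (inj₂ j) = ≤-trans (maxFrom-≥ 0ℚ (lo ∘ IY) j) (maxFrom-default _ (lo ∘ IX))

  L≤hi : ∀ v → L ≤ hi (J v)
  L≤hi (inj₁ i) = minFrom-≤ _ (hi ∘ IX) i
  L≤hi (inj₂ j) = ≤-trans (minFrom-default _ (hi ∘ IX)) (minFrom-≤ 0ℚ (hi ∘ IY) j)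

  L≤U : L ≤ U
  L≤U = ≤-trans (≤-trans (minFrom-default _ (hi ∘ IX)) (minFrom-default 0ℚ (hi ∘ IY)))
                (≤-trans (maxFrom-default 0ℚ (lo ∘ IY)) (maxFrom-default _ (lo ∘ IX)))

  open Corners J L U L≤U lo≤U L≤hi

  rect : Fin (m + n) → Rectangle
  rect u with splitAt m u
  ... | inj₁ i = xCorner (inj₁ i)
  ... | inj₂ j = yCorner (inj₂ j)

  rep : IsRectRep (hat A) rect
  rep u v _ with splitAt m u | splitAt m v
  ... | inj₁ i | inj₁ i' = mk⇔ (λ _ → rise-rise (inj₁ i) (inj₁ i') , fall-fall (inj₁ i) (inj₁ i'))
                               (λ _ → refl)
  ... | inj₁ i | inj₂ j = ⇔-trans (iv i j) (⇔-sym (corner-meets (inj₁ i) (inj₂ j)))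
  ... | inj₂ j | inj₁ i = ⇔-trans (iv i j) (⇔-sym
                             (⇔-trans (RectMeets-sym⇔ (yCorner (inj₂ j)) (xCorner (inj₁ i)))
                                      (corner-meets (inj₁ i) (inj₂ j))))
  ... | inj₂ j | inj₂ j' = mk⇔ (λ _ → fall-fall (inj₂ j) (inj₂ j') , rise-rise (inj₂ j) (inj₂ j'))
                               (λ _ → refl)

  cross : ProjectionsCross rect
  cross u v with splitAt m u | splitAt m v
  ... | inj₁ i | inj₁ i' = inj₁ (rise-rise (inj₁ i) (inj₁ i'))
  ... | inj₁ i | inj₂ j = corner-cross (inj₁ i) (inj₂ j)
  ... | inj₂ j | inj₁ i = Sum.swap (corner-cross (inj₂ j) (inj₁ i))
  ... | inj₂ j | inj₂ j' = inj₁ (fall-fall (inj₂ j) (inj₂ j'))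

corollary5 : (m n : ℕ) (A : BiadjMatrix m n) →
    IsIntervalBigraph A ⇔
      (IsTwoCliqueRectangular (hat A) ×
        Σ (Fin (m + n) → Rectangle) λ R → IsRectRep (hat A) R × ProjectionsCross R)
corollary5 m n A = mk⇔
  (λ model → let (R , rep , cross) = intervalToRectangular A model
             in ((R , rep) , hat-twoCliqueCover A) , (R , rep , cross))
  (λ (_ , (R , rep , cross)) → rectangularToInterval A R rep cross)
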